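{- Let $\mathcal{C}$ be a full comprehension category satisfying condition (LF). If $\mathcal{C}$ has weakly stable zero types, then the split comprehension category $\mathcal{C}_!$ has strictly stable zero types.
   Context: A full comprehension category $\mathcal{C}=(\mathcal{C},\mathcal{T},p,\chi)$: a category $\mathcal{C}$, a cloven Grothendieck fibration $p:\mathcal{T}\to\mathcal{C}$, a fully faithful functor $\chi:\mathcal{T}\to\mathcal{C}^{\to}$ with $\mathrm{cod}\circ\chi=p$ sending cartesian arrows to pullback squares; split if the cleaving is strictly functorial. For $A\in\mathcal{T}(\Gamma)$, $\chi(A):\Gamma.A\to\Gamma$; display maps are composites of these. For $\sigma:\Delta\to\Gamma$, $A[\sigma]$ is the cleaving's reindexing; $f[\sigma]$ the induced reindexing of a map. A section of $A$ is a section of $\chi(A)$. Condition (LF): $\mathcal{C}$ has finite products, and for all $Z\xrightarrow{g}Y\xrightarrow{f}X$ with $f$ a display map and $g$ a display map or product projection, a dependent exponential exists (an object $\prod[f,g]$ of $\mathcal{C}/X$ with $\mathcal{C}/X(W,\prod[f,g])\cong\mathcal{C}/Y(W\times_XY,Z)$ naturally in $W\to X$). $\mathcal{C}_!$: same base; objects of $\mathcal{T}_!$ over $\Gamma$ are triples $A=(V_A,E_A,n_A)$, $V_A\in\mathcal{C}$, $E_A\in\mathcal{T}(V_A)$, $n_A:\Gamma\to V_A$, with $[A]:=E_A[n_A]$; morphisms $B\to A$ over $\sigma$ are morphisms $[B]\to[A]$ over $\sigma$ in $\mathcal{T}$; $(V_A,E_A,n_A)[\sigma]:=(V_A,E_A,n_A\circ\sigma)$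 with the canonical cartesian map; $\chi_!(A):=\chi([A])$. Zero type over $\Gamma$: a type $0\in\mathcal{T}(\Gamma)$ together with, for every $C\in\mathcal{T}(\Gamma.0)$, a section of $C$. Weakly stable zero types: for each $\Gamma$ there is $0\in\mathcal{T}(\Gamma)$ such that for every $\sigma:\Delta\to\Gamma$, $0[\sigma]$ is a zero type over $\Delta$ (i.e. every type over $\Delta.0[\sigma]$ has a section). Strictly stable zero types (split case): functions giving for each $\Gamma$ a zero type $0_\Gamma$ and for each $C\in\mathcal{T}(\Gamma.0_\Gamma)$ a section, both commuting strictly with reindexing. -}

module Defs where

open import Level using (Level; _⊔_) renaming (suc to lsuc)
open import Relation.Binary.PropositionalEquality using (_≡_; refl; sym; trans; cong; subst)
open import Data.Product using (Σ; _×_; _,_; proj₁; proj₂)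
open import Data.Sum using (_⊎_)

record Category (o h : Level) : Set (lsuc (o ⊔ h)) where
  infixr 9 _∘_
  field
    Obj : Set o
    Hom : Obj → Obj → Set h
    id  : ∀ {X} → Hom X X
    _∘_ : ∀ {X Y Z} → Hom Y Z → Hom X Y → Hom X Z
    identityˡ : ∀ {X Y} {f : Hom X Y} → id ∘ f ≡ f
    identityʳ : ∀ {X Y} {f : Hom X Y} → f ∘ id ≡ f
    assoc : ∀ {W X Y Z} {f : Hom W X} {g : Hom X Y} {k : Hom Y Z} →
            (k ∘ g) ∘ f ≡ k ∘ (g ∘ f)

module CatDefs {o h : Level} (C : Category o h) where
  open Category C

  IsPullback : ∀ {P X Y Z} (f : Hom X Z) (g : Hom Y Z)
               (p1 : Hom P X) (p2 : Hom P Y) → Set (o ⊔ h)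
  IsPullback {P} {X} {Y} f g p1 p2 =
    (f ∘ p1 ≡ g ∘ p2) ×
    (∀ {W} (a : Hom W X) (b : Hom W Y) → f ∘ a ≡ g ∘ b →
       Σ (Hom W P) λ u → ((p1 ∘ u ≡ a) × (p2 ∘ u ≡ b)) ×
         (∀ (u' : Hom W P) → p1 ∘ u' ≡ a → p2 ∘ u' ≡ b → u ≡ u'))

  IsProduct : ∀ {P X Y} (p1 : Hom P X) (p2 : Hom P Y) → Set (o ⊔ h)
  IsProduct {P} {X} {Y} p1 p2 =
    ∀ {W} (a : Hom W X) (b : Hom W Y) →
      Σ (Hom W P) λ u → ((p1 ∘ u ≡ a) × (p2 ∘ u ≡ b)) ×
        (∀ (u' : Hom W P) → p1 ∘ u' ≡ a → p2 ∘ u' ≡ b → u ≡ u')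

  IsTerminal : Obj → Set (o ⊔ h)
  IsTerminal T = ∀ (W : Obj) → Σ (Hom W T) λ u → ∀ (u' : Hom W T) → u ≡ u'

  record FiniteProducts : Set (o ⊔ h) where
    field
      ⊤ : Obj
      ⊤-terminal : IsTerminal ⊤
      _×ₒ_ : Obj → Obj → Obj
      π₁ : ∀ {X Y} → Hom (X ×ₒ Y) X
      π₂ : ∀ {X Y} → Hom (X ×ₒ Y) Y
      ×-product : ∀ {X Y} → IsProduct (π₁ {X} {Y}) (π₂ {X} {Y})

  IsProjection : ∀ {Z Y} → Hom Z Y → Set (o ⊔ h)
  IsProjection {Z} {Y} g = Σ Obj λ W → Σ (Hom Z W) λ p2 → IsProduct g p2

  -- Dependent exponential  Π[f,g]  for  Z --g--> Y --f--> X: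
  -- an object (Π, e) of C/X together with a pullback P = Π ×_X Y and an
  -- evaluation ev : P → Z over Y, such that for every W --w--> X and every
  -- pullback Q = W ×_X Y, composing with ev gives a bijection
  --   C/X(W, Π)  ≅  C/Y(Q, Z)
  -- (this is the natural isomorphism C/X(W,Π) ≅ C/Y(W×_X Y, Z), natural in W).
  record DepExp {X Y Z} (f : Hom Y X) (g : Hom Z Y) : Set (o ⊔ h) where
    field
      Π  : Obj
      e  : Hom Π X
      P  : Obj
      p1 : Hom P Π
      p2 : Hom P Y
      pb : IsPullback e f p1 p2
      ev : Hom P Z
      ev-over : g ∘ ev ≡ p2
      universal :
        ∀ {W Q} (w : Hom W X) (q1 : Hom Q W) (q2 : Hom Q Y) →
        IsPullback w f q1 q2 →
        (k : Hom Q Z) → g ∘ k ≡ q2 →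
        Σ (Hom W Π) λ u →
          ((e ∘ u ≡ w) ×
           (∀ (m : Hom Q P) → p1 ∘ m ≡ u ∘ q1 → p2 ∘ m ≡ q2 → ev ∘ m ≡ k)) ×
          (∀ (u' : Hom W Π) → e ∘ u' ≡ w →
             (∀ (m : Hom Q P) → p1 ∘ m ≡ u' ∘ q1 → p2 ∘ m ≡ q2 → ev ∘ m ≡ k) →
             u ≡ u')

-- The total category T is presented by its objects over each Γ (the
-- strict fibres Ty Γ = p⁻¹(Γ)) and its morphisms THom B A, with the
-- functor p given on morphisms by 'base'.

record CompData {o h : Level} (C : Category o h) (t d : Level)
       : Set (lsuc (o ⊔ h ⊔ t ⊔ d)) where
  open Category C
  infixr 9 _∘T_
  field
    Ty   : Obj → Set t
    THom : ∀ {Δ Γ} → Ty Δ → Ty Γ → Set d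
    base : ∀ {Δ Γ} {B : Ty Δ} {A : Ty Γ} → THom B A → Hom Δ Γ
    tid  : ∀ {Γ} {A : Ty Γ} → THom A A
    _∘T_ : ∀ {Θ Δ Γ} {C' : Ty Θ} {B : Ty Δ} {A : Ty Γ} →
           THom B A → THom C' B → THom C' A
    _[_] : ∀ {Δ Γ} → Ty Γ → Hom Δ Γ → Ty Δ
    cart : ∀ {Δ Γ} (A : Ty Γ) (σ : Hom Δ Γ) → THom (A [ σ ]) A
    _⋆_ : (Γ : Obj) → Ty Γ → Obj
    χ   : ∀ {Γ} (A : Ty Γ) → Hom (Γ ⋆ A) Γ
    χm  : ∀ {Δ Γ} {B : Ty Δ} {A : Ty Γ} → THom B A → Hom (Δ ⋆ B) (Γ ⋆ A)

module CompDefs {o h t d : Level} {C : Category o h} (D : CompData C t d) where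
  open Category C
  open CompData D
  open CatDefs C

  IsCartesian : ∀ {Δ Γ} {B : Ty Δ} {A : Ty Γ} → THom B A → Set (o ⊔ h ⊔ t ⊔ d)
  IsCartesian {Δ} {Γ} {B} {A} f =
    ∀ {Θ} (C' : Ty Θ) (g : THom C' A) (τ : Hom Θ Δ) → base g ≡ base f ∘ τ →
      Σ (THom C' B) λ k → ((base k ≡ τ) × (f ∘T k ≡ g)) ×
        (∀ (k' : THom C' B) → base k' ≡ τ → f ∘T k' ≡ g → k ≡ k')

  Section : ∀ {Γ} → Ty Γ → Set h
  Section {Γ} A = Σ (Hom Γ (Γ ⋆ A)) λ s → χ A ∘ s ≡ id

  data IsDisplay : ∀ {Y X} → Hom Y X → Set (o ⊔ h ⊔ t) where
    disp-χ : ∀ {Γ} (A : Ty Γ) → IsDisplay (χ A)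
    disp-∘ : ∀ {X Y Z} {f : Hom Y X} {g : Hom Z Y} →
             IsDisplay f → IsDisplay g → IsDisplay (f ∘ g)

  IsZeroType : ∀ {Γ} → Ty Γ → Set (h ⊔ t)
  IsZeroType {Γ} Z = ∀ (C' : Ty (Γ ⋆ Z)) → Section C'

  HasWeaklyStableZeroTypes : Set (o ⊔ h ⊔ t)
  HasWeaklyStableZeroTypes =
    ∀ (Γ : Obj) → Σ (Ty Γ) λ Z → ∀ {Δ} (σ : Hom Δ Γ) → IsZeroType (Z [ σ ])

  liftZero : (zero : (Γ : Obj) → Ty Γ) →
             (∀ {Δ Γ} (σ : Hom Δ Γ) → zero Γ [ σ ] ≡ zero Δ) →
             ∀ {Δ Γ} (σ : Hom Δ Γ) → Hom (Δ ⋆ zero Δ) (Γ ⋆ zero Γ)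
  liftZero zero zs {Δ} {Γ} σ =
    subst (λ Z → Hom (Δ ⋆ Z) (Γ ⋆ zero Γ)) (zs σ) (χm (cart (zero Γ) σ))

  -- The reindexing s[σ] of a section
  -- s of C along q : Δ' → Γ' is the section of C[q] determined by the pullback
  -- square of the cartesian map cart C q; the equation below says exactly
  -- that the chosen section of C[q] is s[q].
  record HasStrictlyStableZeroTypes : Set (o ⊔ h ⊔ t) where
    field
      zero : (Γ : Obj) → Ty Γ
      zero-stable : ∀ {Δ Γ} (σ : Hom Δ Γ) → zero Γ [ σ ] ≡ zero Δ
      sec : ∀ {Γ} (C' : Ty (Γ ⋆ zero Γ)) → Section C'
      sec-stable :
        ∀ {Δ Γ} (σ : Hom Δ Γ) (C' : Ty (Γ ⋆ zero Γ)) →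
        χm (cart C' (liftZero zero zero-stable σ))
          ∘ proj₁ (sec (C' [ liftZero zero zero-stable σ ]))
        ≡ proj₁ (sec C') ∘ liftZero zero zero-stable σ

  record IsFullComprehension : Set (o ⊔ h ⊔ t ⊔ d) where
    field
      T-identityˡ : ∀ {Δ Γ} {B : Ty Δ} {A : Ty Γ} {f : THom B A} → tid ∘T f ≡ f
      T-identityʳ : ∀ {Δ Γ} {B : Ty Δ} {A : Ty Γ} {f : THom B A} → f ∘T tid ≡ f
      T-assoc : ∀ {Ξ Θ Δ Γ} {D' : Ty Ξ} {C' : Ty Θ} {B : Ty Δ} {A : Ty Γ}
                  {f : THom D' C'} {g : THom C' B} {k : THom B A} →
                  (k ∘T g) ∘T f ≡ k ∘T (g ∘T f)
      base-id : ∀ {Γ} {A : Ty Γ} → base (tid {Γ} {A}) ≡ id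
      base-∘ : ∀ {Θ Δ Γ} {C' : Ty Θ} {B : Ty Δ} {A : Ty Γ}
                 {f : THom B A} {g : THom C' B} → base (f ∘T g) ≡ base f ∘ base g
      cart-base : ∀ {Δ Γ} (A : Ty Γ) (σ : Hom Δ Γ) → base (cart A σ) ≡ σ
      cart-cartesian : ∀ {Δ Γ} (A : Ty Γ) (σ : Hom Δ Γ) → IsCartesian (cart A σ)
      χ-square : ∀ {Δ Γ} {B : Ty Δ} {A : Ty Γ} (f : THom B A) →
                 χ A ∘ χm f ≡ base f ∘ χ B
      χm-id : ∀ {Γ} {A : Ty Γ} → χm (tid {Γ} {A}) ≡ id
      χm-∘ : ∀ {Θ Δ Γ} {C' : Ty Θ} {B : Ty Δ} {A : Ty Γ}
               {f : THom B A} {g : THom C' B} → χm (f ∘T g) ≡ χm f ∘ χm g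
      χ-full : ∀ {Δ Γ} {B : Ty Δ} {A : Ty Γ} (σ : Hom Δ Γ) (u : Hom (Δ ⋆ B) (Γ ⋆ A)) →
               χ A ∘ u ≡ σ ∘ χ B →
               Σ (THom B A) λ f → (base f ≡ σ) × (χm f ≡ u)
      χ-faithful : ∀ {Δ Γ} {B : Ty Δ} {A : Ty Γ} (f g : THom B A) →
                   base f ≡ base g → χm f ≡ χm g → f ≡ g
      χ-pullback : ∀ {Δ Γ} {B : Ty Δ} {A : Ty Γ} (f : THom B A) →
                   IsCartesian f → IsPullback (χ A) (base f) (χm f) (χ B)

record FullComprehensionCategory {o h : Level} (C : Category o h) (t d : Level)
       : Set (lsuc (o ⊔ h ⊔ t ⊔ d)) where
  field
    data' : CompData C t d
    laws  : CompDefs.IsFullComprehension data'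
  open CompData data' public
  open CompDefs data' public
  open IsFullComprehension laws public

module _ {o h t d : Level} {C : Category o h} (𝒞 : FullComprehensionCategory C t d) where
  open Category C
  open CatDefs C
  open FullComprehensionCategory 𝒞

  record LF : Set (o ⊔ h ⊔ t) where
    field
      finiteProducts : FiniteProducts
      depExp : ∀ {X Y Z} {f : Hom Y X} {g : Hom Z Y} →
               IsDisplay f → (IsDisplay g ⊎ IsProjection g) → DepExp f g

record Ty! {o h t : Level} (C : Category o h) (Ty : Category.Obj C → Set t)
           (Γ : Category.Obj C) : Set (o ⊔ h ⊔ t) where
  constructor ty!
  open Category C
  field
    V : Obj
    E : Ty V
    n : Hom Γ V

module _ {o h t d : Level} {C : Category o h} (𝒞 : FullComprehensionCategory C t d) where
  open Category C
  open FullComprehensionCategory 𝒞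

  ⟦_⟧! : ∀ {Γ} → Ty! C Ty Γ → Ty Γ
  ⟦ A ⟧! = Ty!.E A [ Ty!.n A ]

  cart! : ∀ {Δ Γ} (A : Ty! C Ty Γ) (σ : Hom Δ Γ) →
          THom (Ty!.E A [ Ty!.n A ∘ σ ]) ⟦ A ⟧!
  cart! (ty! V E n) σ =
    proj₁ (cart-cartesian E n (E [ n ∘ σ ]) (cart E (n ∘ σ)) σ
      (trans (cart-base E (n ∘ σ)) (cong (_∘ σ) (sym (cart-base E n)))))

  C! : CompData C (o ⊔ h ⊔ t) d
  C! = record
    { Ty   = Ty! C Ty
    ; THom = λ B A → THom ⟦ B ⟧! ⟦ A ⟧!
    ; base = base
    ; tid  = tid
    ; _∘T_ = _∘T_
    ; _[_] = λ A σ → ty! (Ty!.V A) (Ty!.E A) (Ty!.n A ∘ σ)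
    ; cart = cart!
    ; _⋆_  = λ Γ A → Γ ⋆ ⟦ A ⟧!
    ; χ    = λ A → χ ⟦ A ⟧!
    ; χm   = χm
    }

-- Take 0_Γ := (1, 0₁, !_Γ), the weakly stable zero type 0₁ over the terminal object
-- reindexed along !_Γ; it is strictly stable in C_! because ! ∘ σ = !.  Since
-- Γ.0_Γ ≅ Γ × 1.0₁, a type (V, E, n) over Γ.0_Γ is classified by the transpose
-- ň : Γ → Π of n into the exponential Π = V^{1.0₁} given by (LF).  Weak stability
-- yields a single section s₀ of E[ev] over Π.0₁[e], and the
-- section of E[n] is s₀ pulled back along ň.  Strict stability then follows from
-- naturality of transposition, ň ∘ σ being the transpose of n reindexed along σ.
module Submission where

open import Defs
open import Level using (Level)
open import Relation.Binary.PropositionalEquality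
  using (_≡_; refl; sym; trans; cong; subst; module ≡-Reasoning)
open import Data.Product using (Σ; _,_; proj₁; proj₂)
open import Data.Sum using (inj₂)

module CategoryProperties {o h : Level} (C : Category o h) where
  open Category C
  open CatDefs C

  pullˡ : ∀ {W X Y Z} {a : Hom Y Z} {b : Hom X Y} {c : Hom X Z} {f : Hom W X} →
          a ∘ b ≡ c → a ∘ (b ∘ f) ≡ c ∘ f
  pullˡ {f = f} ab≡c = trans (sym assoc) (cong (_∘ f) ab≡c)

  pullʳ : ∀ {W X Y Z} {a : Hom Y Z} {b : Hom X Y} {f : Hom W X} {c : Hom W Y} →
          b ∘ f ≡ c → (a ∘ b) ∘ f ≡ a ∘ c
  pullʳ {a = a} bf≡c = trans assoc (cong (a ∘_) bf≡c)

  module Pullback {P X Y Z} {f : Hom X Z} {g : Hom Y Z} {p1 : Hom P X} {p2 : Hom P Y}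
                  (pb : IsPullback f g p1 p2) where
    commute : f ∘ p1 ≡ g ∘ p2
    commute = proj₁ pb

    module _ {W} {a : Hom W X} {b : Hom W Y} (eq : f ∘ a ≡ g ∘ b) where
      universal : Hom W P
      universal = proj₁ (proj₂ pb a b eq)

      p₁∘universal : p1 ∘ universal ≡ a
      p₁∘universal = proj₁ (proj₁ (proj₂ (proj₂ pb a b eq)))

      p₂∘universal : p2 ∘ universal ≡ b
      p₂∘universal = proj₂ (proj₁ (proj₂ (proj₂ pb a b eq)))

      unique : ∀ (u : Hom W P) → p1 ∘ u ≡ a → p2 ∘ u ≡ b → universal ≡ u
      unique = proj₂ (proj₂ (proj₂ pb a b eq))

    unique-diagram : ∀ {W} {x y : Hom W P} → p1 ∘ x ≡ p1 ∘ y → p2 ∘ x ≡ p2 ∘ y → x ≡ y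
    unique-diagram {x = x} {y} e1 e2 =
      trans (sym (unique eq x e1 e2)) (unique eq y refl refl)
      where
        eq : f ∘ (p1 ∘ y) ≡ g ∘ (p2 ∘ y)
        eq = trans (pullˡ commute) assoc

    swap : IsPullback g f p2 p1
    swap = sym commute , λ a b eq →
      universal (sym eq) , (p₂∘universal (sym eq) , p₁∘universal (sym eq)) ,
      λ u e1 e2 → unique (sym eq) u e2 e1

  module Product {P X Y} {p1 : Hom P X} {p2 : Hom P Y} (prod : IsProduct p1 p2) where
    ⟨_,_⟩ : ∀ {W} → Hom W X → Hom W Y → Hom W P
    ⟨ a , b ⟩ = proj₁ (prod a b)

    project₁ : ∀ {W} {a : Hom W X} {b : Hom W Y} → p1 ∘ ⟨ a , b ⟩ ≡ a
    project₁ {a = a} {b} = proj₁ (proj₁ (proj₂ (prod a b)))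

    project₂ : ∀ {W} {a : Hom W X} {b : Hom W Y} → p2 ∘ ⟨ a , b ⟩ ≡ b
    project₂ {a = a} {b} = proj₂ (proj₁ (proj₂ (prod a b)))

    unique : ∀ {W} {a : Hom W X} {b : Hom W Y} (u : Hom W P) →
             p1 ∘ u ≡ a → p2 ∘ u ≡ b → ⟨ a , b ⟩ ≡ u
    unique {a = a} {b} = proj₂ (proj₂ (prod a b))

    unique-diagram : ∀ {W} {x y : Hom W P} → p1 ∘ x ≡ p1 ∘ y → p2 ∘ x ≡ p2 ∘ y → x ≡ y
    unique-diagram {x = x} {y} e1 e2 = trans (sym (unique x e1 e2)) (unique y refl refl)

    swap : IsProduct p2 p1
    swap a b = ⟨ b , a ⟩ , (project₂ , project₁) , λ u e1 e2 → unique u e2 e1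

  module DepExpProperties {X Y Z} {f : Hom Y X} {g : Hom Z Y} (D : DepExp f g) where
    open DepExp D
    open ≡-Reasoning

    module _ {W Q} {w : Hom W X} {q1 : Hom Q W} {q2 : Hom Q Y}
             (pbQ : IsPullback w f q1 q2) {k : Hom Q Z} (k-over : g ∘ k ≡ q2) where
      transpose : Hom W Π
      transpose = proj₁ (universal w q1 q2 pbQ k k-over)

      e∘transpose : e ∘ transpose ≡ w
      e∘transpose = proj₁ (proj₁ (proj₂ (universal w q1 q2 pbQ k k-over)))

      ev∘transpose : ∀ (m : Hom Q P) → p1 ∘ m ≡ transpose ∘ q1 → p2 ∘ m ≡ q2 → ev ∘ m ≡ k
      ev∘transpose = proj₂ (proj₁ (proj₂ (universal w q1 q2 pbQ k k-over)))

      transpose-unique :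
        ∀ (u : Hom W Π) → e ∘ u ≡ w →
        (∀ (m : Hom Q P) → p1 ∘ m ≡ u ∘ q1 → p2 ∘ m ≡ q2 → ev ∘ m ≡ k) →
        transpose ≡ u
      transpose-unique = proj₂ (proj₂ (universal w q1 q2 pbQ k k-over))

    transpose-natural :
      ∀ {W Q W' Q'} {w : Hom W X} {q1 : Hom Q W} {q2 : Hom Q Y}
        {w' : Hom W' X} {q1' : Hom Q' W'} {q2' : Hom Q' Y}
        (pbQ : IsPullback w f q1 q2) (pbQ' : IsPullback w' f q1' q2')
        {k : Hom Q Z} {k' : Hom Q' Z} (k-over : g ∘ k ≡ q2) (k'-over : g ∘ k' ≡ q2')
        (σ : Hom W' W) (L : Hom Q' Q) →
        w ∘ σ ≡ w' → q1 ∘ L ≡ σ ∘ q1' → q2 ∘ L ≡ q2' → k ∘ L ≡ k' →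
        transpose pbQ' k'-over ≡ transpose pbQ k-over ∘ σ
    transpose-natural {W} {Q} {Q' = Q'} {q1 = q1} {q2} {q1' = q1'} {q2'}
                      pbQ pbQ' {k} {k'} k-over k'-over σ L w∘σ q1∘L q2∘L k∘L =
      transpose-unique pbQ' k'-over (u ∘ σ) (trans (pullˡ (e∘transpose pbQ k-over)) w∘σ) ev∘m
      where
        u : Hom W Π
        u = transpose pbQ k-over

        -- every candidate m factors as m₀ ∘ L
        m₀-eq : e ∘ (u ∘ q1) ≡ f ∘ q2
        m₀-eq = trans (pullˡ (e∘transpose pbQ k-over)) (Pullback.commute pbQ)

        m₀ : Hom Q P
        m₀ = Pullback.universal pb m₀-eq

        p1∘m₀L : p1 ∘ (m₀ ∘ L) ≡ (u ∘ σ) ∘ q1'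
        p1∘m₀L = begin
          p1 ∘ (m₀ ∘ L) ≡⟨ pullˡ (Pullback.p₁∘universal pb m₀-eq) ⟩
          (u ∘ q1) ∘ L  ≡⟨ pullʳ q1∘L ⟩
          u ∘ (σ ∘ q1') ≡⟨ sym assoc ⟩
          (u ∘ σ) ∘ q1' ∎

        p2∘m₀L : p2 ∘ (m₀ ∘ L) ≡ q2'
        p2∘m₀L = trans (pullˡ (Pullback.p₂∘universal pb m₀-eq)) q2∘L

        ev∘m : ∀ (m : Hom Q' P) → p1 ∘ m ≡ (u ∘ σ) ∘ q1' → p2 ∘ m ≡ q2' → ev ∘ m ≡ k'
        ev∘m m p1∘m p2∘m = begin
          ev ∘ m        ≡⟨ cong (ev ∘_) (Pullback.unique-diagram pb
                                          (trans p1∘m (sym p1∘m₀L)) (trans p2∘m (sym p2∘m₀L))) ⟩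
          ev ∘ (m₀ ∘ L) ≡⟨ pullˡ (ev∘transpose pbQ k-over m₀ (Pullback.p₁∘universal pb m₀-eq)
                                                          (Pullback.p₂∘universal pb m₀-eq)) ⟩
          k ∘ L         ≡⟨ k∘L ⟩
          k'            ∎

module ComprehensionProperties {o h t d : Level} {C : Category o h}
                               (𝒞 : FullComprehensionCategory C t d) where
  open Category C
  open CatDefs C
  open CategoryProperties C
  open FullComprehensionCategory 𝒞
  open ≡-Reasoning

  cart-pullback : ∀ {Δ Γ} (A : Ty Γ) (σ : Hom Δ Γ) →
                  IsPullback (χ A) σ (χm (cart A σ)) (χ (A [ σ ]))
  cart-pullback A σ = subst (λ τ → IsPullback (χ A) τ (χm (cart A σ)) (χ (A [ σ ])))
                            (cart-base A σ) (χ-pullback (cart A σ) (cart-cartesian A σ))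

  Lift : ∀ {Δ Γ} → Ty Γ → Hom Δ Γ → Set h
  Lift {Δ} {Γ} A σ = Σ (Hom Δ (Γ ⋆ A)) λ t → χ A ∘ t ≡ σ

  module _ {Δ Γ} {A : Ty Γ} {σ : Hom Δ Γ} where
    open Pullback (cart-pullback A σ)

    Section→Lift : Section (A [ σ ]) → Lift A σ
    Section→Lift (s , χs≡id) =
      χm (cart A σ) ∘ s , trans (pullˡ commute) (trans (pullʳ χs≡id) identityʳ)

    Lift→Section : Lift A σ → Section (A [ σ ])
    Lift→Section (t , χt≡σ) = universal eq , p₂∘universal eq
      where
        eq : χ A ∘ t ≡ σ ∘ id
        eq = trans χt≡σ (sym identityʳ)

    cart∘Lift→Section : ∀ (l : Lift A σ) → χm (cart A σ) ∘ proj₁ (Lift→Section l) ≡ proj₁ l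
    cart∘Lift→Section (t , χt≡σ) = p₁∘universal (trans χt≡σ (sym identityʳ))

  Lift→Section-natural :
    ∀ {Δ Γ V} {A : Ty V} {n : Hom Γ V} (L : Hom Δ Γ) (c : THom (A [ n ∘ L ]) (A [ n ])) →
    base c ≡ L → cart A n ∘T c ≡ cart A (n ∘ L) →
    (l : Lift A n) (l' : Lift A (n ∘ L)) → proj₁ l' ≡ proj₁ l ∘ L →
    χm c ∘ proj₁ (Lift→Section l') ≡ proj₁ (Lift→Section l) ∘ L
  Lift→Section-natural {Δ} {Γ} {A = A} {n} L c base-c cart∘c l l' l'≡l∘L =
    Pullback.unique-diagram (cart-pullback A n)
      (begin
        χm (cart A n) ∘ (χm c ∘ s')     ≡⟨ pullˡ (sym χm-∘) ⟩
        χm (cart A n ∘T c) ∘ s'         ≡⟨ cong (λ x → χm x ∘ s') cart∘c ⟩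
        χm (cart A (n ∘ L)) ∘ s'        ≡⟨ cart∘Lift→Section l' ⟩
        proj₁ l'                        ≡⟨ l'≡l∘L ⟩
        proj₁ l ∘ L                     ≡⟨ cong (_∘ L) (sym (cart∘Lift→Section l)) ⟩
        (χm (cart A n) ∘ s) ∘ L         ≡⟨ assoc ⟩
        χm (cart A n) ∘ (s ∘ L)         ∎)
      (begin
        χ (A [ n ]) ∘ (χm c ∘ s')       ≡⟨ pullˡ (χ-square c) ⟩
        (base c ∘ χ (A [ n ∘ L ])) ∘ s' ≡⟨ pullʳ (proj₂ (Lift→Section l')) ⟩
        base c ∘ id                     ≡⟨ trans identityʳ (trans base-c (sym identityˡ)) ⟩
        id ∘ L                          ≡⟨ cong (_∘ L) (sym (proj₂ (Lift→Section l))) ⟩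
        (χ (A [ n ]) ∘ s) ∘ L           ≡⟨ assoc ⟩
        χ (A [ n ]) ∘ (s ∘ L)           ∎)
    where
      s : Hom Γ (Γ ⋆ (A [ n ]))
      s = proj₁ (Lift→Section l)
      s' : Hom Δ (Δ ⋆ (A [ n ∘ L ]))
      s' = proj₁ (Lift→Section l')

  cart!-base : ∀ {Δ Γ V} (E : Ty V) (n : Hom Γ V) (σ : Hom Δ Γ) →
               base (cart! 𝒞 (ty! V E n) σ) ≡ σ
  cart!-base E n σ = proj₁ (proj₁ (proj₂ (cart-cartesian E n _ (cart E (n ∘ σ)) σ _)))

  cart∘cart! : ∀ {Δ Γ V} (E : Ty V) (n : Hom Γ V) (σ : Hom Δ Γ) →
               cart E n ∘T cart! 𝒞 (ty! V E n) σ ≡ cart E (n ∘ σ)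
  cart∘cart! E n σ = proj₂ (proj₁ (proj₂ (cart-cartesian E n _ (cart E (n ∘ σ)) σ _)))

  -- liftZero of C_!, generalised over the proof of n ∘ σ ≡ n' so that it can be matched on
  module _ {Δ Γ V} (E : Ty V) (n : Hom Γ V) (σ : Hom Δ Γ) where
    weaken! : ∀ {n'} → n ∘ σ ≡ n' → Hom (Δ ⋆ (E [ n' ])) (Γ ⋆ (E [ n ]))
    weaken! e = subst (λ Z → Hom (Δ ⋆ ⟦ 𝒞 ⟧! Z) (Γ ⋆ (E [ n ]))) (cong (ty! V E) e)
                      (χm (cart! 𝒞 (ty! V E n) σ))

    χ∘weaken! : ∀ {n'} (e : n ∘ σ ≡ n') → χ (E [ n ]) ∘ weaken! e ≡ σ ∘ χ (E [ n' ])
    χ∘weaken! refl = trans (χ-square (cart! 𝒞 (ty! V E n) σ))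
                           (cong (_∘ χ (E [ n ∘ σ ])) (cart!-base E n σ))

    cart∘weaken! : ∀ {n'} (e : n ∘ σ ≡ n') → χm (cart E n) ∘ weaken! e ≡ χm (cart E n')
    cart∘weaken! refl = trans (sym χm-∘) (cong χm (cart∘cart! E n σ))

module StrictZeroTypes {o h t d : Level} {C : Category o h}
                       (𝒞 : FullComprehensionCategory C t d) (lf : LF 𝒞)
                       (wsz : FullComprehensionCategory.HasWeaklyStableZeroTypes 𝒞) where
  open Category C
  open CatDefs C
  open CategoryProperties C
  open FullComprehensionCategory 𝒞
  open ComprehensionProperties 𝒞
  open LF lf
  open FiniteProducts finiteProducts
  open module ×-Product {X Y : Obj} = Product (×-product {X} {Y})
    using (⟨_,_⟩; project₁; project₂)
  open ≡-Reasoning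

  ! : ∀ {X} → Hom X ⊤
  ! {X} = proj₁ (⊤-terminal X)

  !-unique : ∀ {X} (f g : Hom X ⊤) → f ≡ g
  !-unique {X} f g = trans (sym (proj₂ (⊤-terminal X) f)) (proj₂ (⊤-terminal X) g)

  O : Ty ⊤
  O = proj₁ (wsz ⊤)

  zero! : (Γ : Obj) → Ty! C Ty Γ
  zero! Γ = ty! ⊤ O !

  zero!-stable : ∀ {Δ Γ} (σ : Hom Δ Γ) → ty! ⊤ O (! ∘ σ) ≡ zero! Δ
  zero!-stable σ = cong (ty! ⊤ O) (!-unique _ _)

  Γ·O-pullback : ∀ {Γ} → IsPullback (! {Γ}) (χ O) (χ (O [ ! ])) (χm (cart O !))
  Γ·O-pullback = Pullback.swap (cart-pullback O !)

  module _ {Δ Γ} (σ : Hom Δ Γ) where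
    weakening : Hom (Δ ⋆ (O [ ! ])) (Γ ⋆ (O [ ! ]))
    weakening = weaken! O ! σ (!-unique (! ∘ σ) !)

    χ∘weakening : χ (O [ ! ]) ∘ weakening ≡ σ ∘ χ (O [ ! ])
    χ∘weakening = χ∘weaken! O ! σ (!-unique (! ∘ σ) !)

    cart∘weakening : χm (cart O !) ∘ weakening ≡ χm (cart O !)
    cart∘weakening = cart∘weaken! O ! σ (!-unique (! ∘ σ) !)

  module Generic (V : Obj) (E : Ty V) where
    D : DepExp (χ O) (π₂ {V} {⊤ ⋆ O})
    D = depExp (disp-χ O) (inj₂ (V , π₁ , Product.swap ×-product))

    open DepExp D
    open DepExpProperties D
    module P-pullback = Pullback pb
    module Π·O-pullback = Pullback (cart-pullback O e)

    Π·O→P : Hom (Π ⋆ (O [ e ])) P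
    Π·O→P = P-pullback.universal (sym Π·O-pullback.commute)

    ev-V : Hom (Π ⋆ (O [ e ])) V
    ev-V = π₁ ∘ (ev ∘ Π·O→P)

    generic : Lift E ev-V
    generic = Section→Lift (proj₂ (wsz ⊤) e (E [ ev-V ]))

    module _ {Γ} (n : Hom (Γ ⋆ (O [ ! ])) V) where
      graph-over : π₂ ∘ ⟨ n , χm (cart O !) ⟩ ≡ χm (cart O !)
      graph-over = project₂

      classify : Hom Γ Π
      classify = transpose Γ·O-pullback graph-over

      classify·O : Hom (Γ ⋆ (O [ ! ])) (Π ⋆ (O [ e ]))
      classify·O = Π·O-pullback.universal
                     (!-unique (χ O ∘ χm (cart O !)) (e ∘ (classify ∘ χ (O [ ! ]))))

      ev-V∘classify·O : ev-V ∘ classify·O ≡ n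
      ev-V∘classify·O = begin
        (π₁ ∘ (ev ∘ Π·O→P)) ∘ classify·O ≡⟨ pullʳ assoc ⟩
        π₁ ∘ (ev ∘ (Π·O→P ∘ classify·O)) ≡⟨ cong (π₁ ∘_) (ev∘transpose Γ·O-pullback graph-over _
                                                                       p1∘ p2∘) ⟩
        π₁ ∘ ⟨ n , χm (cart O !) ⟩       ≡⟨ project₁ ⟩
        n                                ∎
        where
          p1∘ : p1 ∘ (Π·O→P ∘ classify·O) ≡ classify ∘ χ (O [ ! ])
          p1∘ = trans (pullˡ (P-pullback.p₁∘universal _)) (Π·O-pullback.p₂∘universal _)

          p2∘ : p2 ∘ (Π·O→P ∘ classify·O) ≡ χm (cart O !)
          p2∘ = trans (pullˡ (P-pullback.p₂∘universal _)) (Π·O-pullback.p₁∘universal _)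

      lift : Lift E n
      lift = proj₁ generic ∘ classify·O , trans (pullˡ (proj₂ generic)) ev-V∘classify·O

    module _ {Δ Γ} (σ : Hom Δ Γ) (n : Hom (Γ ⋆ (O [ ! ])) V) where
      private
        L : Hom (Δ ⋆ (O [ ! ])) (Γ ⋆ (O [ ! ]))
        L = weakening σ

      classify-natural : classify (n ∘ L) ≡ classify n ∘ σ
      classify-natural =
        transpose-natural Γ·O-pullback Γ·O-pullback (graph-over n) (graph-over (n ∘ L)) σ L
          (!-unique _ _) (χ∘weakening σ) (cart∘weakening σ)
          (×-Product.unique-diagram
            (trans (pullˡ project₁) (sym project₁))
            (trans (pullˡ project₂) (trans (cart∘weakening σ) (sym project₂))))

      classify·O-natural : classify·O (n ∘ L) ≡ classify·O n ∘ L
      classify·O-natural = Π·O-pullback.unique-diagram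
        (trans (Π·O-pullback.p₁∘universal _)
               (sym (trans (pullˡ (Π·O-pullback.p₁∘universal _)) (cart∘weakening σ))))
        (begin
          χ (O [ e ]) ∘ classify·O (n ∘ L) ≡⟨ Π·O-pullback.p₂∘universal _ ⟩
          classify (n ∘ L) ∘ χ (O [ ! ])   ≡⟨ cong (_∘ χ (O [ ! ])) classify-natural ⟩
          (classify n ∘ σ) ∘ χ (O [ ! ])   ≡⟨ pullʳ (sym (χ∘weakening σ)) ⟩
          classify n ∘ (χ (O [ ! ]) ∘ L)   ≡⟨ sym assoc ⟩
          (classify n ∘ χ (O [ ! ])) ∘ L   ≡⟨ cong (_∘ L) (sym (Π·O-pullback.p₂∘universal _)) ⟩
          (χ (O [ e ]) ∘ classify·O n) ∘ L ≡⟨ assoc ⟩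
          χ (O [ e ]) ∘ (classify·O n ∘ L) ∎)

      lift-natural : proj₁ (lift (n ∘ L)) ≡ proj₁ (lift n) ∘ L
      lift-natural = trans (cong (proj₁ generic ∘_) classify·O-natural) (sym assoc)

  -- Opaque, so that checking sec-stable compares sec! applications by their arguments
  -- instead of normalising the proofs inside the sections.
  opaque
    sec! : ∀ {Γ} (C' : Ty! C Ty (Γ ⋆ (O [ ! ]))) → Section (⟦ 𝒞 ⟧! C')
    sec! (ty! V E n) = Lift→Section (Generic.lift V E n)

    sec!-stable : ∀ {Δ Γ V} (σ : Hom Δ Γ) (E : Ty V) (n : Hom (Γ ⋆ (O [ ! ])) V) →
      χm (cart! 𝒞 (ty! V E n) (weakening σ)) ∘ proj₁ (sec! (ty! V E (n ∘ weakening σ)))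
      ≡ proj₁ (sec! (ty! V E n)) ∘ weakening σ
    sec!-stable {V = V} σ E n =
      Lift→Section-natural (weakening σ) (cart! 𝒞 (ty! V E n) (weakening σ))
        (cart!-base E n (weakening σ)) (cart∘cart! E n (weakening σ))
        (lift n) (lift (n ∘ weakening σ)) (lift-natural σ n)
      where open Generic V E

  strictlyStableZeroTypes : CompDefs.HasStrictlyStableZeroTypes (C! 𝒞)
  strictlyStableZeroTypes = record
    { zero = zero!
    ; zero-stable = zero!-stable
    ; sec = sec!
    ; sec-stable = λ { σ (ty! V E n) → sec!-stable σ E n }
    }

lemma3p4p4p4 : ∀ {o h t d : Level} {C : Category o h}
                 (𝒞 : FullComprehensionCategory C t d) →
                 LF 𝒞 →
                 FullComprehensionCategory.HasWeaklyStableZeroTypes 𝒞 →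
                 CompDefs.HasStrictlyStableZeroTypes (C! 𝒞)
lemma3p4p4p4 𝒞 lf wsz = StrictZeroTypes.strictlyStableZeroTypes 𝒞 lf wsz
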